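{- Let $p$ be a prime, let $a$ be a unit of $\mathbb{Z}_p$ and $b\in\mathbb{Z}_p$. Then the discrepancy $D_N$ of the finite sequence $\alpha_n=na+b$, $n=1,\dots,N$, satisfies $D_N=O(N^{ -1/2})$ as $N\to\infty$.
   Context: $\mathbb{Z}_p$ is the ring of $p$-adic integers, with discs $D(c,1/p^k)=c+p^k\mathbb{Z}_p$ for $c\in\mathbb{Z}_p$, $k\ge0$. The discrepancy of $\alpha_1,\dots,\alpha_N$ is $D_N=\sup_{c\in\mathbb{Z}_p,\,k\in\mathbb{N}}\left|\frac{|D(c,1/p^k)\cap\{\alpha_1,\dots,\alpha_N\}|}{N}-\frac1{p^k}\right|$, where the count is the number of indices $n\le N$ with $\alpha_n$ in the disc. -}

module Defs where

open import Data.Nat using (ℕ; zero; suc; _+_; _*_; _^_; NonZero; ∣_-_∣)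
open import Data.Nat.Properties using (m^n≢0)
open import Data.Nat.Divisibility using (_∣_; _∣?_)
open import Data.Nat.Primality using (Prime; prime⇒nonZero)
open import Data.Fin using (Fin; toℕ)
open import Data.List using (List; length; filter; map; upTo)
open import Data.Product using (Σ)
open import Data.Integer using (+_)
open import Data.Rational using (ℚ; _/_; _-_)

-- p-adic integers, represented by their p-adic digit expansion
-- x = Σ_{i ≥ 0} (x i) p^i  with digits x i ∈ {0,…,p-1}.
ℤₚ : ℕ → Set
ℤₚ p = ℕ → Fin p

res : {p : ℕ} → ℤₚ p → ℕ → ℕ
res x zero = 0
res {p} x (suc k) = res x k + toℕ (x k) * p ^ k

CongMod : ℕ → ℕ → ℕ → Set
CongMod m x y = m ∣ ∣ x - y ∣

-- a is a unit of ℤₚ: there is u with a * u = 1, i.e. a*u ≡ 1 mod p^k for all k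
-- (equality in ℤₚ = ℤ/p^k-compatible equality at every level k)
IsUnit : {p : ℕ} → ℤₚ p → Set
IsUnit {p} a = Σ (ℤₚ p) λ u → ∀ k → CongMod (p ^ k) (res a k * res u k) 1

-- α_n = n a + b lies in the disc D(c, 1/p^k) = c + p^k ℤₚ
-- iff  n a + b ≡ c (mod p^k), i.e. n·res a k + res b k ≡ res c k (mod p^k)
-- (reduction mod p^k is a ring homomorphism ℤₚ → ℤ/p^k).
count : {p : ℕ} → ℤₚ p → ℤₚ p → ℕ → ℤₚ p → ℕ → ℕ
count {p} a b N c k =
  length (filter (λ n → p ^ k ∣? ∣ n * res a k + res b k - res c k ∣)
                 (map suc (upTo N)))

discTerm : (p : ℕ) → Prime p → ℤₚ p → ℤₚ p → (N : ℕ) → .{{NonZero N}} →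
           ℤₚ p → ℕ → ℚ
discTerm p pp a b N c k =
  ((+ count a b N c k) / N) - ((+ 1) / (p ^ k)) {{m^n≢0 p k {{prime⇒nonZero pp}}}}

{-# OPTIONS --safe #-}
module Submission where

-- Reduction modulo p^k maps the disc c + p^k ℤₚ to a residue class, and since a is invertible
-- modulo p^k, n a + b ≡ c (mod p^k) holds exactly on one residue class of n.  Among 1, …, N a
-- residue class modulo p^k has ⌊N/p^k⌋ or ⌈N/p^k⌉ members, so |count · p^k − N| ≤ p^k: every
-- term of the discrepancy is at most 1/N, hence D_N ≤ 1/N and N · D_N² ≤ 1.

open import Defs

module Counting where

  open import Data.Bool.Base using (true; false; if_then_else_)
  open import Data.List.Base using (_∷_; length; filter; applyUpTo)
  open import Data.Nat.Base using (ℕ; zero; suc; _+_; _*_; _∸_; _≤_; _<_; _⊔_; ∣_-_∣; NonZero; s≤s)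
  open import Data.Nat.DivMod using (_%_; _/_; m≡m%n+[m/n]*n; [m+n]%n≡m%n; m<n⇒m%n≡m; m%n<n)
  open import Data.Nat.Properties
  open import Function.Base using (_∘_)
  open import Function.Bundles using (_⇔_; Equivalence)
  open import Relation.Binary.PropositionalEquality
  open import Relation.Nullary.Decidable using (yes; no; does; dec-true; dec-false)
  open import Relation.Nullary.Negation using (¬_)
  open import Relation.Unary using (Pred; Decidable)

  open Equivalence using (to; from)

  module _ {p} {P : Pred ℕ p} (P? : Decidable P) where

    𝟙 : ℕ → ℕ
    𝟙 n = if does (P? n) then 1 else 0

    countFrom : ℕ → ℕ → ℕ
    countFrom s zero    = 0
    countFrom s (suc L) = 𝟙 s + countFrom (suc s) L

    𝟙-yes : ∀ {n} → P n → 𝟙 n ≡ 1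
    𝟙-yes {n} pn = cong (if_then 1 else 0) (dec-true (P? n) pn)

    𝟙-no : ∀ {n} → ¬ P n → 𝟙 n ≡ 0
    𝟙-no {n} ¬pn = cong (if_then 1 else 0) (dec-false (P? n) ¬pn)

    length-filter-applyUpTo : ∀ {f} s L → (∀ i → f i ≡ s + i) →
                              length (filter P? (applyUpTo f L)) ≡ countFrom s L
    length-filter-applyUpTo         s zero    f≗s+ = refl
    length-filter-applyUpTo {f = f} s (suc L) f≗s+ = begin
      length (filter P? (f 0 ∷ applyUpTo (f ∘ suc) L))  ≡⟨ length-filter-∷ (f 0) _ ⟩
      𝟙 (f 0) + length (filter P? (applyUpTo (f ∘ suc) L))
        ≡⟨ cong₂ _+_ (cong 𝟙 (trans (f≗s+ 0) (+-identityʳ s)))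
                     (length-filter-applyUpTo (suc s) L (λ i → trans (f≗s+ (suc i)) (+-suc s i))) ⟩
      𝟙 s + countFrom (suc s) L                          ∎
      where
      open ≡-Reasoning
      length-filter-∷ : ∀ x xs → length (filter P? (x ∷ xs)) ≡ 𝟙 x + length (filter P? xs)
      length-filter-∷ x xs with does (P? x)
      ... | true  = refl
      ... | false = refl

    countFrom-+ : ∀ s L₁ L₂ → countFrom s (L₁ + L₂) ≡ countFrom s L₁ + countFrom (s + L₁) L₂
    countFrom-+ s zero     L₂ = cong (λ t → countFrom t L₂) (sym (+-identityʳ s))
    countFrom-+ s (suc L₁) L₂ = begin
      𝟙 s + countFrom (suc s) (L₁ + L₂)                        ≡⟨ cong (𝟙 s +_) (countFrom-+ (suc s) L₁ L₂) ⟩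
      𝟙 s + (countFrom (suc s) L₁ + countFrom (suc s + L₁) L₂) ≡⟨ +-assoc (𝟙 s) _ _ ⟨
      countFrom s (suc L₁) + countFrom (suc s + L₁) L₂         ≡⟨ cong (λ t → countFrom s (suc L₁) + countFrom t L₂) (+-suc s L₁) ⟨
      countFrom s (suc L₁) + countFrom (s + suc L₁) L₂         ∎
      where open ≡-Reasoning

    countFrom-monoʳ-≤ : ∀ s {L₁ L₂} → L₁ ≤ L₂ → countFrom s L₁ ≤ countFrom s L₂
    countFrom-monoʳ-≤ s {L₁} {L₂} L₁≤L₂ = begin
      countFrom s L₁                                      ≤⟨ m≤m+n _ _ ⟩
      countFrom s L₁ + countFrom (s + L₁) (L₂ ∸ L₁)       ≡⟨ countFrom-+ s L₁ (L₂ ∸ L₁) ⟨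
      countFrom s (L₁ + (L₂ ∸ L₁))                        ≡⟨ cong (countFrom s) (m+[n∸m]≡n L₁≤L₂) ⟩
      countFrom s L₂                                      ∎
      where open ≤-Reasoning

    countFrom-none : ∀ s L → (∀ n → s ≤ n → n < L + s → ¬ P n) → countFrom s L ≡ 0
    countFrom-none s zero    none = refl
    countFrom-none s (suc L) none = cong₂ _+_
      (𝟙-no (none s ≤-refl (s≤s (m≤n+m s L))))
      (countFrom-none (suc s) L λ n s<n n<L+1+s →
        none n (<⇒≤ s<n) (subst (n <_) (+-suc L s) n<L+1+s))

    module _ {d} (𝟙-periodic : ∀ n → 𝟙 (n + d) ≡ 𝟙 n) where

      countFrom-suc-window : ∀ s → countFrom (suc s) d ≡ countFrom s d
      countFrom-suc-window s = +-cancelˡ-≡ (𝟙 s) _ _ (begin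
        𝟙 s + countFrom (suc s) d             ≡⟨ cong (countFrom s) (+-comm 1 d) ⟩
        countFrom s (d + 1)                   ≡⟨ countFrom-+ s d 1 ⟩
        countFrom s d + (𝟙 (s + d) + 0)       ≡⟨ cong (λ k → countFrom s d + k) (trans (+-identityʳ _) (𝟙-periodic s)) ⟩
        countFrom s d + 𝟙 s                   ≡⟨ +-comm _ (𝟙 s) ⟩
        𝟙 s + countFrom s d                   ∎)
        where open ≡-Reasoning

      countFrom-window : ∀ s → countFrom s d ≡ countFrom 0 d
      countFrom-window zero    = refl
      countFrom-window (suc s) = trans (countFrom-suc-window s) (countFrom-window s)

      countFrom-windows : ∀ s q → countFrom s (q * d) ≡ q * countFrom 0 d
      countFrom-windows s zero    = refl
      countFrom-windows s (suc q) = begin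
        countFrom s (d + q * d)                       ≡⟨ countFrom-+ s d (q * d) ⟩
        countFrom s d + countFrom (s + d) (q * d)     ≡⟨ cong₂ _+_ (countFrom-window s) (countFrom-windows (s + d) q) ⟩
        countFrom 0 d + q * countFrom 0 d             ∎
        where open ≡-Reasoning

  module _ {p} {P : Pred ℕ p} (P? : Decidable P) (m : ℕ) .{{_ : NonZero m}} {r} (r<m : r < m)
           (P⇔ : ∀ n → P n ⇔ n % m ≡ r) where

    private
      ¬P-below : ∀ {n} → n < m → n ≢ r → ¬ P n
      ¬P-below {n} n<m n≢r pn = n≢r (trans (sym (m<n⇒m%n≡m n<m)) (to (P⇔ n) pn))

      𝟙-periodic : ∀ n → 𝟙 P? (n + m) ≡ 𝟙 P? n
      𝟙-periodic n with P? n
      ... | yes pn = 𝟙-yes P? (from (P⇔ (n + m)) (trans ([m+n]%n≡m%n n m) (to (P⇔ n) pn)))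
      ... | no ¬pn = 𝟙-no P? λ pn+m → ¬pn (from (P⇔ n) (trans (sym ([m+n]%n≡m%n n m)) (to (P⇔ (n + m)) pn+m)))

    residue-window : ∀ s → countFrom P? s m ≡ 1
    residue-window s = begin
      countFrom P? s m                                    ≡⟨ countFrom-window P? 𝟙-periodic s ⟩
      countFrom P? 0 m                                    ≡⟨ cong (countFrom P? 0) m≡r+1+k ⟩
      countFrom P? 0 (r + suc k)                          ≡⟨ countFrom-+ P? 0 r (suc k) ⟩
      countFrom P? 0 r + (𝟙 P? r + countFrom P? (suc r) k)
        ≡⟨ cong₂ _+_ (countFrom-none P? 0 r below-r)
                     (cong₂ _+_ (𝟙-yes P? (from (P⇔ r) (m<n⇒m%n≡m r<m))) (countFrom-none P? (suc r) k above-r)) ⟩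
      1                                                   ∎
      where
      open ≡-Reasoning
      k = m ∸ suc r
      m≡r+1+k : m ≡ r + suc k
      m≡r+1+k = trans (sym (m+[n∸m]≡n r<m)) (sym (+-suc r k))
      below-r : ∀ n → 0 ≤ n → n < r + 0 → ¬ P n
      below-r n _ n<r = ¬P-below (<-trans n<r′ r<m) (<⇒≢ n<r′)
        where n<r′ = subst (n <_) (+-identityʳ r) n<r
      above-r : ∀ n → suc r ≤ n → n < k + suc r → ¬ P n
      above-r n r<n n<k+1+r = ¬P-below (subst (n <_) (trans (+-comm k (suc r)) (m+[n∸m]≡n r<m)) n<k+1+r) (>⇒≢ r<n)

    residue-countFrom-deviation : ∀ s N → ∣ countFrom P? s N * m - N ∣ ≤ m
    residue-countFrom-deviation s N = begin
      ∣ countFrom P? s N * m - N ∣                      ≡⟨ cong (λ L → ∣ countFrom P? s L * m - L ∣) N≡qm+ρ ⟩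
      ∣ countFrom P? s (q * m + ρ) * m - q * m + ρ ∣    ≡⟨ cong (λ c → ∣ c * m - q * m + ρ ∣) count≡q+e ⟩
      ∣ (q + e) * m - q * m + ρ ∣                       ≡⟨ cong (λ x → ∣ x - q * m + ρ ∣) (*-distribʳ-+ m q e) ⟩
      ∣ q * m + e * m - q * m + ρ ∣                     ≡⟨ ∣m+n-m+o∣≡∣n-o∣ (q * m) (e * m) ρ ⟩
      ∣ e * m - ρ ∣                                     ≤⟨ ∣m-n∣≤m⊔n (e * m) ρ ⟩
      e * m ⊔ ρ                                         ≤⟨ ⊔-lub e*m≤m (<⇒≤ (m%n<n N m)) ⟩
      m                                                 ∎
      where
      open ≤-Reasoning
      q = N / m
      ρ = N % m
      e = countFrom P? (s + q * m) ρ

      N≡qm+ρ : N ≡ q * m + ρ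
      N≡qm+ρ = trans (m≡m%n+[m/n]*n N m) (+-comm ρ (q * m))

      count≡q+e : countFrom P? s (q * m + ρ) ≡ q + e
      count≡q+e = begin-equality
        countFrom P? s (q * m + ρ)          ≡⟨ countFrom-+ P? s (q * m) ρ ⟩
        countFrom P? s (q * m) + e          ≡⟨ cong (_+ e) (countFrom-windows P? 𝟙-periodic s q) ⟩
        q * countFrom P? 0 m + e            ≡⟨ cong (λ w → q * w + e) (residue-window 0) ⟩
        q * 1 + e                           ≡⟨ cong (_+ e) (*-identityʳ q) ⟩
        q + e                               ∎

      e≤1 : e ≤ 1
      e≤1 = ≤-trans (countFrom-monoʳ-≤ P? _ (<⇒≤ (m%n<n N m))) (≤-reflexive (residue-window _))

      e*m≤m : e * m ≤ m
      e*m≤m = ≤-trans (*-monoˡ-≤ m e≤1) (≤-reflexive (*-identityˡ m))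

module LinearCongruence where

  open import Data.List.Base using (length; filter; map; upTo)
  open import Data.List.Properties using (map-upTo)
  open import Data.Nat.Base using (ℕ; suc; pred; _+_; _*_; _∸_; _≤_; ∣_-_∣; NonZero)
  open import Data.Nat.Divisibility using (_∣_; _∣?_; divides; m∣m*n)
  open import Data.Nat.DivMod using (_%_; _/_; m≡m%n+[m/n]*n; m%n<n; %-congˡ; %-distribˡ-+; %-distribˡ-*; %-remove-+ʳ)
  open import Data.Nat.Properties
  open import Data.Sum.Base using ([_,_]′)
  open import Function.Base using (_∘_)
  open import Function.Bundles using (_⇔_; mk⇔)
  open import Function.Construct.Composition using (_⇔-∘_)
  open import Relation.Binary.PropositionalEquality

  open Counting using (countFrom; length-filter-applyUpTo; residue-countFrom-deviation)

  module _ (d : ℕ) .{{_ : NonZero d}} where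

    m%d≡n%d⇒d∣∣m-n∣ : ∀ m n → m % d ≡ n % d → d ∣ ∣ m - n ∣
    m%d≡n%d⇒d∣∣m-n∣ m n eq = divides ∣ m / d - n / d ∣ (begin
      ∣ m - n ∣                                       ≡⟨ cong₂ ∣_-_∣ (m≡m%n+[m/n]*n m d) (m≡m%n+[m/n]*n n d) ⟩
      ∣ m % d + m / d * d - n % d + n / d * d ∣       ≡⟨ cong (λ x → ∣ m % d + m / d * d - x + n / d * d ∣) eq ⟨
      ∣ m % d + m / d * d - m % d + n / d * d ∣       ≡⟨ ∣m+n-m+o∣≡∣n-o∣ (m % d) _ _ ⟩
      ∣ m / d * d - n / d * d ∣                       ≡⟨ *-distribʳ-∣-∣ d (m / d) (n / d) ⟨
      ∣ m / d - n / d ∣ * d                           ∎)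
      where open ≡-Reasoning

    d∣∣m-n∣⇒m%d≡n%d : ∀ m n → d ∣ ∣ m - n ∣ → m % d ≡ n % d
    d∣∣m-n∣⇒m%d≡n%d m n d∣∣m-n∣ = [ (λ m≤n → sym (%-shift m≤n d∣∣m-n∣))
                                   , (λ n≤m → %-shift n≤m (subst (d ∣_) (∣-∣-comm m n) d∣∣m-n∣))
                                   ]′ (≤-total m n)
      where
      %-shift : ∀ {x y} → x ≤ y → d ∣ ∣ x - y ∣ → y % d ≡ x % d
      %-shift {x} {y} x≤y d∣∣x-y∣ = begin
        y % d                ≡⟨ %-congˡ (m+[n∸m]≡n x≤y) ⟨
        (x + (y ∸ x)) % d    ≡⟨ %-remove-+ʳ x (subst (d ∣_) (m≤n⇒∣m-n∣≡n∸m x≤y) d∣∣x-y∣) ⟩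
        x % d                ∎
        where open ≡-Reasoning

    d∣∣m-n∣⇔m%d≡n%d : ∀ m n → d ∣ ∣ m - n ∣ ⇔ m % d ≡ n % d
    d∣∣m-n∣⇔m%d≡n%d m n = mk⇔ (d∣∣m-n∣⇒m%d≡n%d m n) (m%d≡n%d⇒d∣∣m-n∣ m n)

    %-cong-+ : ∀ {a b x y} → a % d ≡ b % d → x % d ≡ y % d → (a + x) % d ≡ (b + y) % d
    %-cong-+ {a} {b} {x} {y} a≡b x≡y = begin
      (a + x) % d                ≡⟨ %-distribˡ-+ a x d ⟩
      (a % d + x % d) % d        ≡⟨ cong₂ (λ u v → (u + v) % d) a≡b x≡y ⟩
      (b % d + y % d) % d        ≡⟨ %-distribˡ-+ b y d ⟨
      (b + y) % d                ∎
      where open ≡-Reasoning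

    %-cong-* : ∀ {a b x y} → a % d ≡ b % d → x % d ≡ y % d → (a * x) % d ≡ (b * y) % d
    %-cong-* {a} {b} {x} {y} a≡b x≡y = begin
      (a * x) % d                ≡⟨ %-distribˡ-* a x d ⟩
      (a % d * (x % d)) % d      ≡⟨ cong₂ (λ u v → (u * v) % d) a≡b x≡y ⟩
      (b % d * (y % d)) % d      ≡⟨ %-distribˡ-* b y d ⟨
      (b * y) % d                ∎
      where open ≡-Reasoning

    [x+b]%d≡y%d⇔x%d≡[y+c]%d : ∀ {b c x y} → d ∣ b + c → (x + b) % d ≡ y % d ⇔ x % d ≡ (y + c) % d
    [x+b]%d≡y%d⇔x%d≡[y+c]%d {b} {c} {x} {y} d∣b+c = mk⇔
      (λ x+b≡y → begin
        x % d                ≡⟨ %-remove-+ʳ x d∣b+c ⟨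
        (x + (b + c)) % d    ≡⟨ %-congˡ (+-assoc x b c) ⟨
        (x + b + c) % d      ≡⟨ %-cong-+ x+b≡y refl ⟩
        (y + c) % d          ∎)
      (λ x≡y+c → begin
        (x + b) % d          ≡⟨ %-cong-+ x≡y+c refl ⟩
        (y + c + b) % d      ≡⟨ %-congˡ (+-assoc y c b) ⟩
        (y + (c + b)) % d    ≡⟨ %-remove-+ʳ y (subst (d ∣_) (+-comm b c) d∣b+c) ⟩
        y % d                ∎)
      where open ≡-Reasoning

    [x*a]%d≡y%d⇔x%d≡[y*u]%d : ∀ {a u x y} → (a * u) % d ≡ 1 % d → (x * a) % d ≡ y % d ⇔ x % d ≡ (y * u) % d
    [x*a]%d≡y%d⇔x%d≡[y*u]%d {a} {u} {x} {y} au≡1 = mk⇔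
      (λ xa≡y → begin
        x % d                ≡⟨ %-congˡ (*-identityʳ x) ⟨
        (x * 1) % d          ≡⟨ %-cong-* {x} {x} {a * u} refl au≡1 ⟨
        (x * (a * u)) % d    ≡⟨ %-congˡ (*-assoc x a u) ⟨
        (x * a * u) % d      ≡⟨ %-cong-* xa≡y refl ⟩
        (y * u) % d          ∎)
      (λ x≡yu → begin
        (x * a) % d          ≡⟨ %-cong-* x≡yu refl ⟩
        (y * u * a) % d      ≡⟨ %-congˡ (trans (*-assoc y u a) (cong (y *_) (*-comm u a))) ⟩
        (y * (a * u)) % d    ≡⟨ %-cong-* {y} {y} {a * u} refl au≡1 ⟩
        (y * 1) % d          ≡⟨ %-congˡ (*-identityʳ y) ⟩
        y % d                ∎)
      where open ≡-Reasoning

    -- pred d * b plays the role of −b modulo d.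
    linear-congruence : ∀ {a u} → (a * u) % d ≡ 1 % d → ∀ b c n →
                        d ∣ ∣ n * a + b - c ∣ ⇔ n % d ≡ ((c + pred d * b) * u) % d
    linear-congruence au≡1 b c n =
      [x*a]%d≡y%d⇔x%d≡[y*u]%d au≡1 ⇔-∘ ([x+b]%d≡y%d⇔x%d≡[y+c]%d d∣b+[d-1]b ⇔-∘ d∣∣m-n∣⇔m%d≡n%d (n * _ + b) c)
      where
      d∣b+[d-1]b : d ∣ b + pred d * b
      d∣b+[d-1]b = subst (λ e → d ∣ e * b) (sym (suc-pred d)) (m∣m*n b)

  linear-count-deviation : ∀ d .{{_ : NonZero d}} a u b c → d ∣ ∣ a * u - 1 ∣ → ∀ N →
    ∣ length (filter (λ n → d ∣? ∣ n * a + b - c ∣) (map suc (upTo N))) * d - N ∣ ≤ d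
  linear-count-deviation d a u b c d∣au-1 N =
    subst (λ k → ∣ k * d - N ∣ ≤ d) (sym length≡countFrom)
      (residue-countFrom-deviation Q? d (m%n<n _ d) (linear-congruence d au≡1 b c) 1 N)
    where
    Q? = λ n → d ∣? ∣ n * a + b - c ∣
    au≡1 = d∣∣m-n∣⇒m%d≡n%d d (a * u) 1 d∣au-1
    length≡countFrom : length (filter Q? (map suc (upTo N))) ≡ countFrom Q? 1 N
    length≡countFrom = trans (cong (length ∘ filter Q?) (map-upTo suc N))
                             (length-filter-applyUpTo Q? 1 N λ _ → refl)

module Deviation where

  open import Data.Integer.Base as ℤ using (+_; _⊖_; +≤+)
  import Data.Integer.Properties as ℤ
  open import Data.Nat.Base as ℕ using (suc; _≤_; ∣_-_∣; NonZero)
  import Data.Nat.Properties as ℕ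
  open import Data.Nat.Solver using (module +-*-Solver)
  open import Data.Rational.Base as ℚ using (1ℚ; toℚᵘ)
  open import Data.Rational.Properties using (toℚᵘ-cancel-≤; toℚᵘ-fromℚᵘ; toℚᵘ-homo-*; toℚᵘ-homo-+; toℚᵘ-homo‿-; toℚᵘ-homo-∣-∣)
  open import Data.Rational.Unnormalised.Base as ℚᵘ using (*≤*; _≃_)
  open import Data.Rational.Unnormalised.Properties using (≃-trans; ≃-sym; ≤-respˡ-≃; *-cong; +-cong; -‿cong; ∣-∣-cong)
  open import Data.Sum.Base using (inj₁; inj₂)
  open import Relation.Binary.PropositionalEquality

  ∣m⊖n∣≡∣m-n∣ : ∀ m n → ℤ.∣ m ⊖ n ∣ ≡ ∣ m - n ∣
  ∣m⊖n∣≡∣m-n∣ m n with ℕ.≤-total m n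
  ... | inj₁ m≤n = trans (ℤ.∣⊖∣-≤ m≤n) (sym (ℕ.m≤n⇒∣m-n∣≡n∸m m≤n))
  ... | inj₂ n≤m = trans (ℤ.∣m⊖n∣≡∣n⊖m∣ m n) (trans (ℤ.∣⊖∣-≤ n≤m) (sym (ℕ.m≤n⇒∣n-m∣≡n∸m n≤m)))

  -- i ℚ./ suc n unfolds to fromℚᵘ (i ℚᵘ./ suc n).
  toℚᵘ-/ : ∀ i n .{{_ : NonZero n}} → toℚᵘ (i ℚ./ n) ≃ i ℚᵘ./ n
  toℚᵘ-/ i (suc n) = toℚᵘ-fromℚᵘ (i ℚᵘ./ suc n)

  squared-deviationᵘ-bound : ∀ c N m → ∣ c ℕ.* suc m - suc N ∣ ≤ suc m →
    let x = (+ c ℚᵘ./ suc N) ℚᵘ.- (+ 1 ℚᵘ./ suc m) in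
    ℚᵘ.∣ x ∣ ℚᵘ.* ℚᵘ.∣ x ∣ ℚᵘ.* (+ suc N ℚᵘ./ 1) ℚᵘ.≤ ℚᵘ.1ℚᵘ
  squared-deviationᵘ-bound c N m dev =
    *≤* (subst₂ ℤ._≤_ (sym numerator) (sym (ℤ.*-identityˡ _)) (+≤+ D²N≤[Nm]²))
    where
    x = (+ c ℚᵘ./ suc N) ℚᵘ.- (+ 1 ℚᵘ./ suc m)
    D = ℤ.∣ ℚᵘ.↥ x ∣

    D≤m : D ≤ suc m
    D≤m = subst (_≤ suc m) (sym (trans (cong ℤ.∣_∣ ↥x≡cm⊖N) (∣m⊖n∣≡∣m-n∣ (c ℕ.* suc m) (suc N)))) dev
      where
      ↥x≡cm⊖N : ℚᵘ.↥ x ≡ (c ℕ.* suc m) ⊖ suc N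
      ↥x≡cm⊖N = trans (cong₂ ℤ._+_ (sym (ℤ.pos-* c (suc m))) (ℤ.-1*i≡-i (+ suc N))) (ℤ.m-n≡m⊖n (c ℕ.* suc m) (suc N))

    numerator : ℚᵘ.↥ (ℚᵘ.∣ x ∣ ℚᵘ.* ℚᵘ.∣ x ∣ ℚᵘ.* (+ suc N ℚᵘ./ 1)) ℤ.* + 1 ≡ + (D ℕ.* D ℕ.* suc N)
    numerator = trans (ℤ.*-identityʳ _)
      (trans (cong (ℤ._* + suc N) (sym (ℤ.pos-* D D))) (sym (ℤ.pos-* (D ℕ.* D) (suc N))))

    -- the right-hand side is the unreduced ℚᵘ denominator of the goal's left-hand side
    D²N≤[Nm]² : D ℕ.* D ℕ.* suc N ≤ suc N ℕ.* suc m ℕ.* (suc N ℕ.* suc m) ℕ.* 1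
    D²N≤[Nm]² = begin
      D ℕ.* D ℕ.* suc N                           ≤⟨ ℕ.*-mono-≤ (ℕ.*-mono-≤ D≤m D≤m) (ℕ.m≤m*n (suc N) (suc N)) ⟩
      suc m ℕ.* suc m ℕ.* (suc N ℕ.* suc N)       ≡⟨ solve 2 (λ M N → M :* M :* (N :* N) := N :* M :* (N :* M) :* con 1)
                                                            refl (suc m) (suc N) ⟩
      suc N ℕ.* suc m ℕ.* (suc N ℕ.* suc m) ℕ.* 1 ∎
      where
      open ℕ.≤-Reasoning
      open +-*-Solver

  deviation-bound : ∀ c N m .{{_ : NonZero N}} .{{_ : NonZero m}} → ∣ c ℕ.* m - N ∣ ≤ m →
    let t = (+ c ℚ./ N) ℚ.- (+ 1 ℚ./ m) in
    ℚ.∣ t ∣ ℚ.* ℚ.∣ t ∣ ℚ.* (+ N ℚ./ 1) ℚ.≤ 1ℚ ℚ.* 1ℚ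
  deviation-bound c (suc N) (suc m) dev =
    toℚᵘ-cancel-≤ (≤-respˡ-≃ (≃-sym toℚᵘ-t²N) (squared-deviationᵘ-bound c N m dev))
    where
    t = (+ c ℚ./ suc N) ℚ.- (+ 1 ℚ./ suc m)
    x = (+ c ℚᵘ./ suc N) ℚᵘ.- (+ 1 ℚᵘ./ suc m)

    toℚᵘ-t : toℚᵘ t ≃ x
    toℚᵘ-t = ≃-trans (toℚᵘ-homo-+ (+ c ℚ./ suc N) (ℚ.- (+ 1 ℚ./ suc m)))
      (+-cong (toℚᵘ-/ (+ c) (suc N)) (≃-trans (toℚᵘ-homo‿- (+ 1 ℚ./ suc m)) (-‿cong (toℚᵘ-/ (+ 1) (suc m)))))

    toℚᵘ-t²N : toℚᵘ (ℚ.∣ t ∣ ℚ.* ℚ.∣ t ∣ ℚ.* (+ suc N ℚ./ 1)) ≃ ℚᵘ.∣ x ∣ ℚᵘ.* ℚᵘ.∣ x ∣ ℚᵘ.* (+ suc N ℚᵘ./ 1)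
    toℚᵘ-t²N = ≃-trans (toℚᵘ-homo-* (ℚ.∣ t ∣ ℚ.* ℚ.∣ t ∣) (+ suc N ℚ./ 1))
      (*-cong (≃-trans (toℚᵘ-homo-* ℚ.∣ t ∣ ℚ.∣ t ∣) (*-cong toℚᵘ-∣t∣ toℚᵘ-∣t∣)) (toℚᵘ-/ (+ suc N) 1))
      where
      toℚᵘ-∣t∣ : toℚᵘ ℚ.∣ t ∣ ≃ ℚᵘ.∣ x ∣
      toℚᵘ-∣t∣ = ≃-trans (toℚᵘ-homo-∣-∣ t) (∣-∣-cong toℚᵘ-t)

open import Data.Nat using (ℕ; NonZero; _^_) renaming (_≤_ to _≤ℕ_)
open import Data.Nat.Primality using (Prime; prime⇒nonZero)
open import Data.Nat.Properties using (m^n≢0)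
open import Data.Product using (Σ; _,_)
open import Data.Integer using (+_)
open import Data.Rational using (ℚ; _≤_; _*_; ∣_∣; _/_; 1ℚ)
open LinearCongruence using (linear-count-deviation)
open Deviation using (deviation-bound)

corollary1p4 : (p : ℕ) (pp : Prime p) (a b : ℤₚ p) → IsUnit a →
    Σ ℚ λ C → Σ ℕ λ N₀ → (N : ℕ) .{{_ : NonZero N}} → N₀ ≤ℕ N →
      (c : ℤₚ p) (k : ℕ) →
        ∣ discTerm p pp a b N c k ∣ * ∣ discTerm p pp a b N c k ∣ * ((+ N) / 1) ≤ C * C
corollary1p4 p pp a b (u , au≡1) = 1ℚ , 0 , λ N _ c k →
  let instance _ = m^n≢0 p k {{prime⇒nonZero pp}} in
  deviation-bound (count a b N c k) N (p ^ k)
    (linear-count-deviation (p ^ k) (res a k) (res u k) (res b k) (res c k) (au≡1 k) N)
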